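{- Let $k_1,\dots,k_s, r$ be nonnegative integers with $n = k_1 + \dots + k_s + r$, and let $\mathcal F_1,\dots,\mathcal F_s \subset 2^{[n]}$. Choose a permutation $(y_1,\dots,y_n)$ of $[n]$ uniformly at random, and set $P_i = \{y_{k_1+\dots+k_{i-1}+1}, \dots, y_{k_1+\dots+k_i}\}$ for $1 \leq i \leq s$, and $R = \{y_{n-r+1},\dots,y_n\}$. Let $\sigma: R \to [r]$ be given by $\sigma(y_{n-r+t}) = t$ for $1 \leq t \leq r$. For $1 \leq i \leq s$ define $\mathcal G_i = \{G \subset [r] : P_i \cup \sigma^{ -1}(G) \in \mathcal F_i\}$. Then: (i) if $\mathcal F_1,\dots,\mathcal F_s$ are cross-dependent, then $\mathcal G_1,\dots,\mathcal G_s$ are cross-dependent as well (for every outcome of the permutation); (ii) for each $1 \leq i \leq s$ and $0 \leq j \leq r$, the expected value $\gamma_i(j)$ of $\bigl|\mathcal G_i \cap \binom{[r]}{j}\bigr|\big/\binom{r}{j}$ satisfies $\gamma_i(j) = \varphi_i(k_i + j)$.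
   Context: $[m]=\{1,\dots,m\}$, $\binom{[m]}{j}$ is the set of $j$-element subsets of $[m]$. For $0 \leq \ell \leq n$, $\varphi_i(\ell) = \bigl|\mathcal F_i \cap \binom{[n]}{\ell}\bigr| \big/ \binom{n}{\ell}$. Families $\mathcal F_1,\dots,\mathcal F_s$ are called cross-dependent if there is no choice of $F_1 \in \mathcal F_1, \dots, F_s \in \mathcal F_s$ such that $F_1,\dots,F_s$ are pairwise disjoint. -}

module Defs where

open import Data.Bool using (Bool; true; false; _∧_; _∨_; T?)
open import Relation.Nullary.Decidable using (⌊_⌋)
import Data.Nat.ListAction as LA
open import Data.Nat using (ℕ; zero; suc; _+_; _≤ᵇ_; _<ᵇ_; _≡ᵇ_)
open import Data.Fin using (Fin; toℕ; _≟_) renaming (zero to fzero; suc to fsuc)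
open import Data.Fin.Subset using (Subset; _∩_; ∣_∣; Empty)
open import Data.List using (List; []; _∷_; [_]; map; concatMap; filter; length; allFin; take)
import Data.List as L
open import Data.Vec using (Vec; []; _∷_; tabulate; lookup; toList; _++_)
import Data.Vec as V
open import Data.Product using (Σ; _×_)
open import Relation.Nullary using (¬_)
open import Relation.Binary.PropositionalEquality using (_≡_; _≢_)
import Data.List.Relation.Unary.Unique.DecPropositional as UniqueD

-- A family of subsets of [m] (elements of [m] are Fin m, subsets are
-- characteristic vectors Subset m = Vec Bool m), given by its indicator.
Family : ℕ → Set
Family m = Subset m → Bool

CrossDependent : {s m : ℕ} → (Fin s → Family m) → Set
CrossDependent {s} {m} 𝓕 =
  ¬ (Σ (Fin s → Subset m) λ F →
       ((i : Fin s) → 𝓕 i (F i) ≡ true) ×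
       ((i j : Fin s) → i ≢ j → Empty (F i ∩ F j)))

allSubsets : (m : ℕ) → List (Subset m)
allSubsets zero = [ [] ]
allSubsets (suc m) = concatMap (λ S → (false ∷ S) ∷ (true ∷ S) ∷ []) (allSubsets m)

layerCount : {m : ℕ} → Family m → ℕ → ℕ
layerCount {m} 𝓕 ℓ = length (filter (λ S → T? (𝓕 S ∧ (∣ S ∣ ≡ᵇ ℓ))) (allSubsets m))

allSeqs : (m l : ℕ) → List (Vec (Fin m) l)
allSeqs m zero = [ [] ]
allSeqs m (suc l) = concatMap (λ x → map (x ∷_) (allSeqs m l)) (allFin m)

IsPerm : {n : ℕ} → Vec (Fin n) n → Set
IsPerm y = UniqueD.Unique _≟_ (toList y)

-- All permutations (y₁,…,yₙ) of [n] (sample space of the uniform choice).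
allPerms : (n : ℕ) → List (Vec (Fin n) n)
allPerms n = filter (λ y → UniqueD.unique? _≟_ (toList y)) (allSeqs n n)

total : {s : ℕ} → Vec ℕ s → ℕ
total k = V.sum k

offset : {s : ℕ} → Vec ℕ s → Fin s → ℕ
offset k i = LA.sum (take (toℕ i) (toList k))

-- Positions (0-indexed) of block Pᵢ among the first K positions.
blockMask : {s : ℕ} → (k : Vec ℕ s) → Fin s → Vec Bool (total k)
blockMask k i = tabulate λ p →
  (offset k i ≤ᵇ toℕ p) ∧ (toℕ p <ᵇ (offset k i + lookup k i))

anyFin : {n : ℕ} → (Fin n → Bool) → Bool
anyFin {zero} f = false
anyFin {suc n} f = f fzero ∨ anyFin (λ p → f (fsuc p))

image : {m l : ℕ} → Vec (Fin m) l → Vec Bool l → Subset m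
image y S = tabulate λ x → anyFin λ p → lookup S p ∧ ⌊ lookup y p ≟ x ⌋

-- 𝓖ᵢ = {G ⊆ [r] : Pᵢ ∪ σ⁻¹(G) ∈ 𝓕ᵢ}, where n = K + r, the last r
-- positions form R, and σ(y_{K+t}) = t.  Pᵢ ∪ σ⁻¹(G) is the image under y
-- of the position set (block i) ++ G.
derived : {s r : ℕ} → (k : Vec ℕ s) → Vec (Fin (total k + r)) (total k + r) →
          (Fin s → Family (total k + r)) → Fin s → Family r
derived k y 𝓕 i G = 𝓕 i (image y (blockMask k i ++ G))

module Submission where

-- Part (i): Pᵢ ∪ σ⁻¹(Gᵢ) is the image under the injective sequence y of the position set
-- (block i) ++ Gᵢ. The blocks are pairwise disjoint, so pairwise disjoint Gᵢ give pairwise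
-- disjoint members of the 𝓕ᵢ.
--
-- Part (ii) is double counting. For a family f on [n] and a set Q of positions let orbitCount f Q
-- be the number of permutations y with y(Q) ∈ f. Replacing y by y ∘ π shows that orbitCount f is
-- invariant under permutations of the positions, and such a function of Q depends only on |Q|,
-- since transpositions move the elements of one set onto those of any other set of the same size.
-- Summing over the C(n, m) sets Q of size m counts the pairs (y, F) with F ∈ f and |F| = m, so
-- each value is n! |f ∩ binom([n], m)| / C(n, m). Finally Σ_y |𝓖ᵢ ∩ binom([r], j)| is the sum of
-- orbitCount 𝓕ᵢ over the C(r, j) position sets (block i) ++ G with |G| = j, all of size kᵢ + j.

open import Defs
open import Algebra.Properties.CommutativeSemigroup using (interchange)
open import Data.Bool using (Bool; true; false; _∧_; _∨_; T?)
open import Data.Bool.Properties using (⇔→≡; T-≡; T-∧)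
open import Data.Empty using (⊥; ⊥-elim)
open import Data.Fin using (Fin; toℕ; _≟_; punchOut) renaming (zero to fzero; suc to fsuc)
open import Data.Fin.Permutation
  using (Permutation′; _⟨$⟩ʳ_; _⟨$⟩ˡ_; flip; inverseˡ; inverseʳ; transpose; lift₀)
open import Data.Fin.Properties using (any?; punchOut-injective; injective⇒≤; toℕ-injective)
open import Data.Fin.Subset using (Subset; ∣_∣; _∩_; Empty)
open import Data.Fin.Subset.Properties using (x∈p∩q⁺; x∈p∩q⁻; drop-∷-Empty)
open import Data.List using (List; []; _∷_; map; length; filter; concatMap; allFin)
import Data.List as List
open import Data.List.Membership.Propositional using (_∈_)
open import Data.List.Membership.Propositional.Properties
  using (∈-map⁺; ∈-map⁻; ∈-concatMap⁺; ∈-concatMap⁻; ∈-allFin; ∈-filter⁺; ∈-filter⁻)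
open import Data.List.Membership.Propositional.Properties.WithK using (unique∧set⇒bag)
open import Data.List.Properties using (map-++; map-∘; map-tabulate)
open import Data.List.Relation.Binary.BagAndSetEquality using (∼bag⇒↭)
import Data.List.Relation.Binary.Permutation.Propositional.Properties as ↭
open import Data.List.Relation.Unary.All using ([]; _∷_)
open import Data.List.Relation.Unary.All.Properties using (All¬⇒¬Any)
open import Data.List.Relation.Unary.AllPairs using ([]; _∷_)
open import Data.List.Relation.Unary.Any using (here; there)
import Data.List.Relation.Unary.Any as Any
import Data.List.Relation.Unary.Unique.DecPropositional as UniqueD
open import Data.List.Relation.Unary.Unique.Propositional using (Unique)
import Data.List.Relation.Unary.Unique.Propositional.Properties as Unique
open import Data.Nat using (ℕ; zero; suc; _+_; _*_; _≤_; _<_; z≤n; s≤s; _≡ᵇ_; _≤ᵇ_; _<ᵇ_)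
open import Data.Nat.Combinatorics using (_C_; nCk+nC[k+1]≡[n+1]C[k+1])
open import Data.Nat.ListAction using (sum)
open import Data.Nat.ListAction.Properties using (sum-++; sum-↭)
open import Data.Nat.Properties
  using (+-identityʳ; +-comm; +-assoc; +-commutativeSemigroup; *-zeroʳ; *-comm; *-assoc;
         *-distribˡ-+; suc-injective; m≤m+n; +-monoʳ-≤; ≤-trans; <-≤-trans; <-irrefl; <-cmp;
         1+n≰n; ≡ᵇ⇒≡; ≤ᵇ⇒≤; <ᵇ⇒<)
open import Data.Product using (∃; _×_; _,_; proj₂)
open import Data.Vec using (Vec; []; _∷_; lookup; head; tail; toList; tabulate; _[_]≔_; _++_)
open import Data.Vec.Properties
  using (lookup∘tabulate; tabulate∘lookup; tabulate-cong; lookup∘update; lookup∘update′;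
         []=⇒lookup; lookup⇒[]=)
open import Data.Vec.Relation.Unary.All.Properties using (lookup⁺; lookup⁻; toList⁺; toList⁻)
open import Function.Bundles using (Equivalence; mk⇔)
open import Function.Definitions using (Injective)
open import Relation.Binary.Definitions using (tri<; tri≈; tri>)
open import Relation.Binary.PropositionalEquality
  using (_≡_; _≢_; refl; sym; trans; subst; cong; cong₂; module ≡-Reasoning)
open import Relation.Nullary using (yes; no)
open import Relation.Nullary.Decidable using (⌊_⌋; dec-true; isYes≗does)

private variable
  A B : Set

-- Sums over lists

∑ : List A → (A → ℕ) → ℕ
∑ l f = sum (map f l)

syntax ∑ l (λ x → e) = ∑[ x ← l ] e

𝕀 : Bool → ℕ
𝕀 true  = 1
𝕀 false = 0

𝕀-∧ : ∀ a b → 𝕀 (a ∧ b) ≡ 𝕀 a * 𝕀 b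
𝕀-∧ true  b = sym (+-identityʳ (𝕀 b))
𝕀-∧ false b = refl

length-filter≡∑𝕀 : (l : List A) (p : A → Bool) →
                   length (filter (λ x → T? (p x)) l) ≡ ∑[ x ← l ] 𝕀 (p x)
length-filter≡∑𝕀 []      p = refl
length-filter≡∑𝕀 (x ∷ l) p with p x
... | true  = cong suc (length-filter≡∑𝕀 l p)
... | false = length-filter≡∑𝕀 l p

∑-cong : (l : List A) {f g : A → ℕ} → (∀ {x} → x ∈ l → f x ≡ g x) → ∑ l f ≡ ∑ l g
∑-cong []      f≡g = refl
∑-cong (x ∷ l) f≡g = cong₂ _+_ (f≡g (here refl)) (∑-cong l (λ x∈l → f≡g (there x∈l)))

∑-+ : (l : List A) (f g : A → ℕ) → ∑[ x ← l ] (f x + g x) ≡ ∑ l f + ∑ l g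
∑-+ []      f g = refl
∑-+ (x ∷ l) f g = trans (cong (f x + g x +_) (∑-+ l f g))
                        (interchange +-commutativeSemigroup (f x) (g x) (∑ l f) (∑ l g))

∑-*ˡ : (l : List A) (c : ℕ) (f : A → ℕ) → ∑[ x ← l ] (c * f x) ≡ c * ∑ l f
∑-*ˡ []      c f = sym (*-zeroʳ c)
∑-*ˡ (x ∷ l) c f = trans (cong (c * f x +_) (∑-*ˡ l c f)) (sym (*-distribˡ-+ c (f x) (∑ l f)))

∑-*ʳ : (l : List A) (c : ℕ) (f : A → ℕ) → ∑[ x ← l ] (f x * c) ≡ ∑ l f * c
∑-*ʳ l c f = begin
  ∑[ x ← l ] (f x * c)  ≡⟨ ∑-cong l (λ {x} _ → *-comm (f x) c) ⟩
  ∑[ x ← l ] (c * f x)  ≡⟨ ∑-*ˡ l c f ⟩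
  c * ∑ l f             ≡⟨ *-comm c (∑ l f) ⟩
  ∑ l f * c             ∎
  where open ≡-Reasoning

∑-const : (l : List A) (c : ℕ) → ∑[ _ ← l ] c ≡ length l * c
∑-const []      c = refl
∑-const (x ∷ l) c = cong (c +_) (∑-const l c)

∑-concatMap : (l : List A) (f : A → List B) (g : B → ℕ) →
              ∑ (concatMap f l) g ≡ ∑[ x ← l ] ∑ (f x) g
∑-concatMap []      f g = refl
∑-concatMap (x ∷ l) f g = begin
  sum (map g (f x List.++ concatMap f l))          ≡⟨ cong sum (map-++ g (f x) (concatMap f l)) ⟩
  sum (map g (f x) List.++ map g (concatMap f l))  ≡⟨ sum-++ (map g (f x)) _ ⟩
  ∑ (f x) g + ∑ (concatMap f l) g                  ≡⟨ cong (∑ (f x) g +_) (∑-concatMap l f g) ⟩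
  ∑ (f x) g + ∑[ x ← l ] ∑ (f x) g                 ∎
  where open ≡-Reasoning

∑-comm : (l : List A) (l′ : List B) (h : A → B → ℕ) →
         ∑[ x ← l ] ∑[ y ← l′ ] h x y ≡ ∑[ y ← l′ ] ∑[ x ← l ] h x y
∑-comm []      l′ h = sym (trans (∑-const l′ 0) (*-zeroʳ (length l′)))
∑-comm (x ∷ l) l′ h = trans (cong (∑ l′ (h x) +_) (∑-comm l l′ h)) (sym (∑-+ l′ (h x) _))

∑-indicator : (l : List A) (p : A → Bool) (g : A → ℕ) (c : ℕ) →
              (∀ {x} → x ∈ l → p x ≡ true → g x ≡ c) →
              ∑[ x ← l ] (𝕀 (p x) * g x) ≡ ∑[ x ← l ] 𝕀 (p x) * c
∑-indicator l p g c g≡c = trans (∑-cong l pointwise) (∑-*ʳ l c (λ x → 𝕀 (p x)))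
  where
  pointwise : ∀ {x} → x ∈ l → 𝕀 (p x) * g x ≡ 𝕀 (p x) * c
  pointwise {x} x∈l with p x in px
  ... | true  = cong (1 *_) (g≡c x∈l px)
  ... | false = refl

∑-reindex : {l : List A} (f : A → A) → Unique l → Injective _≡_ _≡_ f →
            (∀ {x} → x ∈ l → f x ∈ l) → (∀ {x} → x ∈ l → ∃ λ z → z ∈ l × f z ≡ x) →
            (g : A → ℕ) → ∑[ x ← l ] g (f x) ≡ ∑ l g
∑-reindex {l = l} f l! f-inj f-into f-onto g = begin
  sum (map (λ x → g (f x)) l)  ≡⟨ cong sum (map-∘ l) ⟩
  sum (map g (map f l))        ≡⟨ sum-↭ (↭.map⁺ g map-f-l↭l) ⟩
  sum (map g l)                ∎
  where
  open ≡-Reasoning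
  map-f-l↭l = ∼bag⇒↭ (unique∧set⇒bag (Unique.map⁺ f-inj l!) l! (mk⇔ to from))
    where
    to : ∀ {x} → x ∈ map f l → x ∈ l
    to x∈ with z , z∈l , refl ← ∈-map⁻ f x∈ = f-into z∈l
    from : ∀ {x} → x ∈ l → x ∈ map f l
    from x∈l with z , z∈l , refl ← f-onto x∈l = ∈-map⁺ f z∈l

-- Enumerations

unique-concatMap⁺ : {l : List A} (f : A → List B) (key : B → A) →
                    (∀ {x z} → z ∈ f x → key z ≡ x) →
                    Unique l → (∀ x → Unique (f x)) → Unique (concatMap f l)
unique-concatMap⁺ {l = []}    f key keyed []          f! = []
unique-concatMap⁺ {l = x ∷ l} f key keyed (x∉l ∷ l!) f! =
  Unique.++⁺ (f! x) (unique-concatMap⁺ f key keyed l! f!) disjoint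
  where
  disjoint : ∀ {z} → z ∈ f x × z ∈ concatMap f l → ⊥
  disjoint (z∈fx , z∈rest) = All¬⇒¬Any x∉l
    (Any.map (λ z∈fx′ → trans (sym (keyed z∈fx)) (keyed z∈fx′)) (∈-concatMap⁻ f z∈rest))

∈-allSubsets : ∀ {m} (S : Subset m) → S ∈ allSubsets m
∈-allSubsets []      = here refl
∈-allSubsets (b ∷ S) = ∈-concatMap⁺ (λ S → (false ∷ S) ∷ (true ∷ S) ∷ [])
  (Any.map (λ { refl → ∈-pair b }) (∈-allSubsets S))
  where
  ∈-pair : ∀ b → (b ∷ S) ∈ (false ∷ S) ∷ (true ∷ S) ∷ []
  ∈-pair false = here refl
  ∈-pair true  = there (here refl)

allSubsets-unique : ∀ m → Unique (allSubsets m)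
allSubsets-unique zero    = [] ∷ []
allSubsets-unique (suc m) = unique-concatMap⁺ _ tail keyed (allSubsets-unique m)
  (λ S → ((λ ()) ∷ []) ∷ [] ∷ [])
  where
  keyed : ∀ {S Z} → Z ∈ (false ∷ S) ∷ (true ∷ S) ∷ [] → tail Z ≡ S
  keyed (here refl)         = refl
  keyed (there (here refl)) = refl

∈-allSeqs : ∀ m {l} (v : Vec (Fin m) l) → v ∈ allSeqs m l
∈-allSeqs m []      = here refl
∈-allSeqs m (x ∷ v) = ∈-concatMap⁺ (λ x → map (x ∷_) (allSeqs m _))
  (Any.map (λ { refl → ∈-map⁺ (x ∷_) (∈-allSeqs m v) }) (∈-allFin x))

allSeqs-unique : ∀ m l → Unique (allSeqs m l)
allSeqs-unique m zero    = [] ∷ []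
allSeqs-unique m (suc l) = unique-concatMap⁺ _ head keyed (Unique.allFin⁺ m)
  (λ x → Unique.map⁺ ∷-injectiveʳ (allSeqs-unique m l))
  where
  keyed : ∀ {x z} → z ∈ map (x ∷_) (allSeqs m l) → head z ≡ x
  keyed z∈ with _ , _ , refl ← ∈-map⁻ _ z∈ = refl
  ∷-injectiveʳ : ∀ {x} {u v : Vec (Fin m) l} → x ∷ u ≡ x ∷ v → u ≡ v
  ∷-injectiveʳ refl = refl

∈-allPerms⁺ : ∀ {n} {y : Vec (Fin n) n} → IsPerm y → y ∈ allPerms n
∈-allPerms⁺ y! = ∈-filter⁺ (λ y → UniqueD.unique? _≟_ (toList y)) (∈-allSeqs _ _) y!

∈-allPerms⁻ : ∀ {n} {y : Vec (Fin n) n} → y ∈ allPerms n → IsPerm y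
∈-allPerms⁻ {n} y∈ = proj₂ (∈-filter⁻ (λ y → UniqueD.unique? _≟_ (toList y)) {xs = allSeqs n n} y∈)

allPerms-unique : ∀ n → Unique (allPerms n)
allPerms-unique n = Unique.filter⁺ (λ y → UniqueD.unique? _≟_ (toList y)) (allSeqs-unique n n)

∑𝕀[∣S∣≡j]≡mCj : ∀ m j → ∑[ S ← allSubsets m ] 𝕀 (∣ S ∣ ≡ᵇ j) ≡ m C j
∑𝕀[∣S∣≡j]≡mCj zero    zero    = refl
∑𝕀[∣S∣≡j]≡mCj zero    (suc j) = refl
∑𝕀[∣S∣≡j]≡mCj (suc m) j       = begin
  ∑ (allSubsets (suc m)) (λ S → 𝕀 (∣ S ∣ ≡ᵇ j))
    ≡⟨ ∑-concatMap (allSubsets m) _ _ ⟩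
  ∑[ S ← allSubsets m ] (𝕀 (∣ S ∣ ≡ᵇ j) + (𝕀 (suc ∣ S ∣ ≡ᵇ j) + 0))
    ≡⟨ ∑-cong (allSubsets m) (λ {S} _ → cong (𝕀 (∣ S ∣ ≡ᵇ j) +_) (+-identityʳ _)) ⟩
  ∑[ S ← allSubsets m ] (𝕀 (∣ S ∣ ≡ᵇ j) + 𝕀 (suc ∣ S ∣ ≡ᵇ j))
    ≡⟨ ∑-+ (allSubsets m) _ _ ⟩
  ∑[ S ← allSubsets m ] 𝕀 (∣ S ∣ ≡ᵇ j) + ∑[ S ← allSubsets m ] 𝕀 (suc ∣ S ∣ ≡ᵇ j)
    ≡⟨ pascal j ⟩
  suc m C j ∎
  where
  open ≡-Reasoning
  pascal : ∀ j → ∑[ S ← allSubsets m ] 𝕀 (∣ S ∣ ≡ᵇ j) + ∑[ S ← allSubsets m ] 𝕀 (suc ∣ S ∣ ≡ᵇ j)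
                 ≡ suc m C j
  pascal zero    = cong₂ _+_ (∑𝕀[∣S∣≡j]≡mCj m zero)
                             (trans (∑-const (allSubsets m) 0) (*-zeroʳ (length (allSubsets m))))
  pascal (suc j) = begin
    ∑[ S ← allSubsets m ] 𝕀 (∣ S ∣ ≡ᵇ suc j) + ∑[ S ← allSubsets m ] 𝕀 (∣ S ∣ ≡ᵇ j)
      ≡⟨ cong₂ _+_ (∑𝕀[∣S∣≡j]≡mCj m (suc j)) (∑𝕀[∣S∣≡j]≡mCj m j) ⟩
    m C suc j + m C j   ≡⟨ +-comm (m C suc j) (m C j) ⟩
    m C j + m C suc j   ≡⟨ nCk+nC[k+1]≡[n+1]C[k+1] m j ⟩
    suc m C suc j       ∎

∣S∣≡∑𝕀 : ∀ {n} (S : Subset n) → ∣ S ∣ ≡ ∑[ x ← allFin n ] 𝕀 (lookup S x)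
∣S∣≡∑𝕀 {n} S =
  trans (∣S∣≡sum-tabulate S) (sym (cong sum (map-tabulate (λ x → x) (λ x → 𝕀 (lookup S x)))))
  where
  ∣S∣≡sum-tabulate : ∀ {n} (S : Subset n) → ∣ S ∣ ≡ sum (List.tabulate (λ x → 𝕀 (lookup S x)))
  ∣S∣≡sum-tabulate []          = refl
  ∣S∣≡sum-tabulate (true ∷ S)  = cong suc (∣S∣≡sum-tabulate S)
  ∣S∣≡sum-tabulate (false ∷ S) = ∣S∣≡sum-tabulate S

-- Images of position sets under a sequence

unique⇒lookup-injective : ∀ {l} {v : Vec A l} → Unique (toList v) → Injective _≡_ _≡_ (lookup v)
unique⇒lookup-injective {v = x ∷ v} (x∉v ∷ v!) {fzero}  {fzero}  _ = refl
unique⇒lookup-injective {v = x ∷ v} (x∉v ∷ v!) {fzero}  {fsuc q} e = ⊥-elim (lookup⁺ (toList⁻ x∉v) q e)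
unique⇒lookup-injective {v = x ∷ v} (x∉v ∷ v!) {fsuc p} {fzero}  e = ⊥-elim (lookup⁺ (toList⁻ x∉v) p (sym e))
unique⇒lookup-injective {v = x ∷ v} (x∉v ∷ v!) {fsuc p} {fsuc q} e = cong fsuc (unique⇒lookup-injective v! e)

lookup-injective⇒unique : ∀ {l} {v : Vec A l} → Injective _≡_ _≡_ (lookup v) → Unique (toList v)
lookup-injective⇒unique {v = []}    _     = []
lookup-injective⇒unique {v = x ∷ v} v-inj =
  toList⁺ (lookup⁻ (λ q x≡vq → fzero≢fsuc (v-inj {fzero} {fsuc q} x≡vq)))
  ∷ lookup-injective⇒unique (λ e → fsuc-injective (v-inj e))
  where
  fzero≢fsuc : ∀ {n} {q : Fin n} → fzero ≢ fsuc q
  fzero≢fsuc ()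
  fsuc-injective : ∀ {n} {p q : Fin n} → fsuc p ≡ fsuc q → p ≡ q
  fsuc-injective refl = refl

injective⇒surjective : ∀ {n} {f : Fin n → Fin n} → Injective _≡_ _≡_ f → ∀ x → ∃ λ p → f p ≡ x
injective⇒surjective {suc n} {f} f-inj x with any? (λ p → f p ≟ x)
... | yes hit  = hit
... | no  miss = ⊥-elim (1+n≰n (injective⇒≤ g-inj))
  where
  g : Fin (suc n) → Fin n
  g p = punchOut {i = x} {j = f p} (λ x≡fp → miss (p , sym x≡fp))
  g-inj : Injective _≡_ _≡_ g
  g-inj {p} {q} gp≡gq =
    f-inj (punchOut-injective {i = x} (λ e → miss (p , sym e)) (λ e → miss (q , sym e)) gp≡gq)

lookup-ext : ∀ {n} {u v : Vec A n} → (∀ i → lookup u i ≡ lookup v i) → u ≡ v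
lookup-ext {u = u} {v} u≗v = trans (sym (tabulate∘lookup u)) (trans (tabulate-cong u≗v) (tabulate∘lookup v))

anyFin⁺ : ∀ {n} (f : Fin n → Bool) p → f p ≡ true → anyFin f ≡ true
anyFin⁺ f fzero    fp = cong (_∨ anyFin (λ q → f (fsuc q))) fp
anyFin⁺ f (fsuc p) fp with f fzero
... | true  = refl
... | false = anyFin⁺ (λ q → f (fsuc q)) p fp

anyFin⁻ : ∀ {n} (f : Fin n → Bool) → anyFin f ≡ true → ∃ λ p → f p ≡ true
anyFin⁻ {suc n} f any with f fzero in f0
... | true  = fzero , f0
... | false with p , fp ← anyFin⁻ (λ q → f (fsuc q)) any = fsuc p , fp

module _ {m l : ℕ} (y : Vec (Fin m) l) (S : Subset l) where

  lookup-image⁺ : ∀ {p x} → lookup S p ≡ true → lookup y p ≡ x → lookup (image y S) x ≡ true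
  lookup-image⁺ {p} {x} Sp refl = trans (lookup∘tabulate _ x)
    (anyFin⁺ _ p (cong₂ _∧_ Sp ⌊yp≟yp⌋))
    where
    ⌊yp≟yp⌋ : ⌊ lookup y p ≟ lookup y p ⌋ ≡ true
    ⌊yp≟yp⌋ = trans (isYes≗does _) (dec-true (lookup y p ≟ lookup y p) refl)

  lookup-image⁻ : ∀ {x} → lookup (image y S) x ≡ true → ∃ λ p → lookup S p ≡ true × lookup y p ≡ x
  lookup-image⁻ {x} x∈ with p , hit ← anyFin⁻ _ (trans (sym (lookup∘tabulate _ x)) x∈)
                        with lookup S p in Sp | lookup y p ≟ x
  ... | true | yes yp≡x = p , Sp , yp≡x

reindex : ∀ {n m} → (Fin n → Fin m) → Vec A m → Vec A n
reindex σ v = tabulate (λ p → lookup v (σ p))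

module _ {n : ℕ} (y : Vec (Fin n) n) (y-inj : Injective _≡_ _≡_ (lookup y)) where

  lookup-image : ∀ S p → lookup (image y S) (lookup y p) ≡ lookup S p
  lookup-image S p = ⇔→≡ (mk⇔ reflect (λ Sp → lookup-image⁺ y S Sp refl))
    where
    reflect : lookup (image y S) (lookup y p) ≡ true → lookup S p ≡ true
    reflect hit with q , Sq , yq≡yp ← lookup-image⁻ y S hit = subst (λ r → lookup S r ≡ true) (y-inj yq≡yp) Sq

  reindex-image : ∀ S → reindex (lookup y) (image y S) ≡ S
  reindex-image S = lookup-ext (λ p → trans (lookup∘tabulate _ p) (lookup-image S p))

  image-reindex : ∀ S → image y (reindex (lookup y) S) ≡ S
  image-reindex S = lookup-ext pointwise
    where
    pointwise : ∀ x → lookup (image y (reindex (lookup y) S)) x ≡ lookup S x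
    pointwise x with p , refl ← injective⇒surjective y-inj x =
      trans (lookup-image (reindex (lookup y) S) p) (lookup∘tabulate _ p)

  image-injective : Injective _≡_ _≡_ (image y)
  image-injective {S} {S′} eq = begin
    S                               ≡⟨ sym (reindex-image S) ⟩
    reindex (lookup y) (image y S)  ≡⟨ cong (reindex (lookup y)) eq ⟩
    reindex (lookup y) (image y S′) ≡⟨ reindex-image S′ ⟩
    S′                              ∎
    where open ≡-Reasoning

  ∣image∣ : ∀ S → ∣ image y S ∣ ≡ ∣ S ∣
  ∣image∣ S = begin
    ∣ image y S ∣
      ≡⟨ ∣S∣≡∑𝕀 (image y S) ⟩
    ∑[ x ← allFin n ] 𝕀 (lookup (image y S) x)
      ≡⟨ ∑-reindex (lookup y) (Unique.allFin⁺ n) y-inj (λ _ → ∈-allFin _) onto _ ⟨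
    ∑[ p ← allFin n ] 𝕀 (lookup (image y S) (lookup y p))
      ≡⟨ ∑-cong (allFin n) (λ {p} _ → cong 𝕀 (lookup-image S p)) ⟩
    ∑[ p ← allFin n ] 𝕀 (lookup S p)
      ≡⟨ ∣S∣≡∑𝕀 S ⟨
    ∣ S ∣ ∎
    where
    open ≡-Reasoning
    onto : ∀ {x} → x ∈ allFin n → ∃ λ p → p ∈ allFin n × lookup y p ≡ x
    onto {x} _ with p , yp≡x ← injective⇒surjective y-inj x = p , ∈-allFin p , yp≡x

  ∑-image : (g : Subset n → ℕ) → ∑[ S ← allSubsets n ] g (image y S) ≡ ∑ (allSubsets n) g
  ∑-image = ∑-reindex (image y) (allSubsets-unique n) image-injective (λ _ → ∈-allSubsets _)
    (λ {S} _ → reindex (lookup y) S , ∈-allSubsets _ , image-reindex S)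

-- Permuting positions

permute : ∀ {n} → Permutation′ n → Vec A n → Vec A n
permute π = reindex (π ⟨$⟩ʳ_)

lookup-permute : ∀ {n} (π : Permutation′ n) (v : Vec A n) p →
                 lookup (permute π v) p ≡ lookup v (π ⟨$⟩ʳ p)
lookup-permute π v = lookup∘tabulate _

permute-flip : ∀ {n} (π : Permutation′ n) (v : Vec A n) → permute (flip π) (permute π v) ≡ v
permute-flip π v = lookup-ext λ p →
  trans (lookup-permute (flip π) (permute π v) p) (trans (lookup-permute π v _) (cong (lookup v) (inverseʳ π)))

image-permute : ∀ {m n} (y : Vec (Fin m) n) (π : Permutation′ n) S →
                image y (permute π S) ≡ image (permute (flip π) y) S
image-permute y π S = lookup-ext λ x → ⇔→≡ (mk⇔ (forth x) (back x))
  where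
  forth : ∀ x → lookup (image y (permute π S)) x ≡ true → lookup (image (permute (flip π) y) S) x ≡ true
  forth x hit with p , Sπp , yp≡x ← lookup-image⁻ y (permute π S) hit =
    lookup-image⁺ (permute (flip π) y) S (trans (sym (lookup-permute π S p)) Sπp)
      (trans (lookup-permute (flip π) y _) (trans (cong (lookup y) (inverseˡ π)) yp≡x))
  back : ∀ x → lookup (image (permute (flip π) y) S) x ≡ true → lookup (image y (permute π S)) x ≡ true
  back x hit with q , Sq , yπ⁻¹q≡x ← lookup-image⁻ (permute (flip π) y) S hit =
    lookup-image⁺ y (permute π S) (trans (lookup-permute π S _) (trans (cong (lookup S) (inverseʳ π)) Sq))
      (trans (sym (lookup-permute (flip π) y q)) yπ⁻¹q≡x)

permute-IsPerm : ∀ {n} (π : Permutation′ n) {y : Vec (Fin n) n} → IsPerm y → IsPerm (permute π y)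
permute-IsPerm π {y} y! = lookup-injective⇒unique λ {p} {q} eq →
  trans (sym (inverseˡ π)) (trans (cong (π ⟨$⟩ˡ_) (unique⇒lookup-injective y!
    (trans (sym (lookup-permute π y p)) (trans eq (lookup-permute π y q))))) (inverseˡ π))

∑-permute : ∀ {n} (π : Permutation′ n) (g : Vec (Fin n) n → ℕ) →
            ∑[ y ← allPerms n ] g (permute π y) ≡ ∑ (allPerms n) g
∑-permute {n} π = ∑-reindex (permute π) (allPerms-unique n) permute-injective
  (λ y∈ → ∈-allPerms⁺ (permute-IsPerm π (∈-allPerms⁻ y∈)))
  (λ {y} y∈ → permute (flip π) y , ∈-allPerms⁺ (permute-IsPerm (flip π) (∈-allPerms⁻ y∈)) ,
               permute-flip (flip π) y)
  where
  permute-injective : Injective _≡_ _≡_ (permute π)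
  permute-injective {u} {v} eq =
    trans (sym (permute-flip π u)) (trans (cong (permute (flip π)) eq) (permute-flip π v))

∣S∣≡1+k⇒∃removal : ∀ {n k} (S : Subset n) → ∣ S ∣ ≡ suc k →
                   ∃ λ p → lookup S p ≡ true × ∣ S [ p ]≔ false ∣ ≡ k
∣S∣≡1+k⇒∃removal (true  ∷ S) ∣S∣≡1+k = fzero , refl , suc-injective ∣S∣≡1+k
∣S∣≡1+k⇒∃removal (false ∷ S) ∣S∣≡1+k
  with p , Sp , ∣S-p∣ ← ∣S∣≡1+k⇒∃removal S ∣S∣≡1+k = fsuc p , Sp , ∣S-p∣

permute-transpose-head : ∀ {n} (S : Subset n) p → lookup S p ≡ true →
                         permute (transpose fzero (fsuc p)) (false ∷ S) ≡ true ∷ (S [ p ]≔ false)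
permute-transpose-head S p Sp = lookup-ext λ i → trans (lookup-permute τ (false ∷ S) i) (pointwise i)
  where
  τ = transpose fzero (fsuc p)
  pointwise : ∀ i → lookup (false ∷ S) (τ ⟨$⟩ʳ i) ≡ lookup (true ∷ (S [ p ]≔ false)) i
  pointwise fzero = Sp
  pointwise (fsuc i) with i ≟ p
  ... | yes refl = sym (lookup∘update i S false)
  ... | no  i≢p  = sym (lookup∘update′ i≢p S false)

PermutationInvariant : ∀ {n} → (Subset n → B) → Set
PermutationInvariant h = ∀ π S → h (permute π S) ≡ h S

invariant⇒∣∣-determined : ∀ {n} {h : Subset n → B} → PermutationInvariant h →
                          ∀ {S S′} → ∣ S ∣ ≡ ∣ S′ ∣ → h S ≡ h S′
invariant⇒∣∣-determined {n = zero}  _ {[]} {[]} _ = refl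
invariant⇒∣∣-determined {n = suc n} {h} h-inv {b ∷ S} {c ∷ S′} = heads b c
  where
  open ≡-Reasoning
  sameHead : ∀ b {R R′} → ∣ R ∣ ≡ ∣ R′ ∣ → h (b ∷ R) ≡ h (b ∷ R′)
  sameHead b = invariant⇒∣∣-determined (λ π R → h-inv (lift₀ π) (b ∷ R))
  true≡false : ∀ {R R′} → suc ∣ R ∣ ≡ ∣ R′ ∣ → h (true ∷ R) ≡ h (false ∷ R′)
  true≡false {R} {R′} eq with p , R′p , ∣R′-p∣ ← ∣S∣≡1+k⇒∃removal R′ (sym eq) = begin
    h (true ∷ R)                                       ≡⟨ sameHead true (sym ∣R′-p∣) ⟩
    h (true ∷ (R′ [ p ]≔ false))                       ≡⟨ cong h (permute-transpose-head R′ p R′p) ⟨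
    h (permute (transpose fzero (fsuc p)) (false ∷ R′)) ≡⟨ h-inv (transpose fzero (fsuc p)) (false ∷ R′) ⟩
    h (false ∷ R′)                                     ∎
  heads : ∀ b c → ∣ b ∷ S ∣ ≡ ∣ c ∷ S′ ∣ → h (b ∷ S) ≡ h (c ∷ S′)
  heads true  true  eq = sameHead true (suc-injective eq)
  heads false false eq = sameHead false eq
  heads true  false eq = true≡false eq
  heads false true  eq = sym (true≡false (sym eq))

-- Counting permutations that map a position set into a family

layerCount≡∑ : ∀ {n} (f : Family n) ℓ →
               layerCount f ℓ ≡ ∑[ S ← allSubsets n ] (𝕀 (∣ S ∣ ≡ᵇ ℓ) * 𝕀 (f S))
layerCount≡∑ {n} f ℓ = trans (length-filter≡∑𝕀 (allSubsets n) (λ S → f S ∧ (∣ S ∣ ≡ᵇ ℓ)))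
  (∑-cong (allSubsets n) (λ {S} _ → trans (𝕀-∧ (f S) _) (*-comm (𝕀 (f S)) _)))

orbitCount : ∀ {n} → Family n → Subset n → ℕ
orbitCount {n} f Q = ∑[ y ← allPerms n ] 𝕀 (f (image y Q))

orbitCount-invariant : ∀ {n} (f : Family n) → PermutationInvariant (orbitCount f)
orbitCount-invariant {n} f π Q = begin
  ∑[ y ← allPerms n ] 𝕀 (f (image y (permute π Q)))
    ≡⟨ ∑-cong (allPerms n) (λ {y} _ → cong (λ T → 𝕀 (f T)) (image-permute y π Q)) ⟩
  ∑[ y ← allPerms n ] 𝕀 (f (image (permute (flip π) y) Q))
    ≡⟨ ∑-permute (flip π) (λ y → 𝕀 (f (image y Q))) ⟩
  orbitCount f Q ∎
  where open ≡-Reasoning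

orbitCount-layer : ∀ {n} (f : Family n) {ℓ} (Q : Subset n) → ∣ Q ∣ ≡ ℓ →
                   orbitCount f Q * (n C ℓ) ≡ length (allPerms n) * layerCount f ℓ
orbitCount-layer {n} f {ℓ} Q ∣Q∣≡ℓ = begin
  orbitCount f Q * (n C ℓ)
    ≡⟨ *-comm (orbitCount f Q) (n C ℓ) ⟩
  (n C ℓ) * orbitCount f Q
    ≡⟨ cong (_* orbitCount f Q) (∑𝕀[∣S∣≡j]≡mCj n ℓ) ⟨
  ∑[ S ← allSubsets n ] 𝕀 (∣ S ∣ ≡ᵇ ℓ) * orbitCount f Q
    ≡⟨ ∑-indicator (allSubsets n) (λ S → ∣ S ∣ ≡ᵇ ℓ) (orbitCount f) _ sameLayer ⟨
  ∑[ S ← allSubsets n ] (𝕀 (∣ S ∣ ≡ᵇ ℓ) * orbitCount f S)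
    ≡⟨ ∑-cong (allSubsets n) (λ {S} _ →
         ∑-*ˡ (allPerms n) (𝕀 (∣ S ∣ ≡ᵇ ℓ)) (λ y → 𝕀 (f (image y S)))) ⟨
  ∑[ S ← allSubsets n ] ∑[ y ← allPerms n ] (𝕀 (∣ S ∣ ≡ᵇ ℓ) * 𝕀 (f (image y S)))
    ≡⟨ ∑-comm (allSubsets n) (allPerms n) _ ⟩
  ∑[ y ← allPerms n ] ∑[ S ← allSubsets n ] (𝕀 (∣ S ∣ ≡ᵇ ℓ) * 𝕀 (f (image y S)))
    ≡⟨ ∑-cong (allPerms n) (λ {y} y∈ → ∑-cong (allSubsets n) (λ {S} _ →
         cong (λ k → 𝕀 (k ≡ᵇ ℓ) * 𝕀 (f (image y S))) (∣image∣ y (injective y∈) S))) ⟨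
  ∑[ y ← allPerms n ] ∑[ S ← allSubsets n ] (𝕀 (∣ image y S ∣ ≡ᵇ ℓ) * 𝕀 (f (image y S)))
    ≡⟨ ∑-cong (allPerms n) (λ {y} y∈ →
         ∑-image y (injective y∈) (λ T → 𝕀 (∣ T ∣ ≡ᵇ ℓ) * 𝕀 (f T))) ⟩
  ∑[ y ← allPerms n ] ∑[ T ← allSubsets n ] (𝕀 (∣ T ∣ ≡ᵇ ℓ) * 𝕀 (f T))
    ≡⟨ ∑-cong (allPerms n) (λ _ → layerCount≡∑ f ℓ) ⟨
  ∑[ y ← allPerms n ] layerCount f ℓ
    ≡⟨ ∑-const (allPerms n) _ ⟩
  length (allPerms n) * layerCount f ℓ ∎
  where
  open ≡-Reasoning
  injective : ∀ {y} → y ∈ allPerms n → Injective _≡_ _≡_ (lookup y)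
  injective y∈ = unique⇒lookup-injective (∈-allPerms⁻ y∈)
  sameLayer : ∀ {S} → S ∈ allSubsets n → (∣ S ∣ ≡ᵇ ℓ) ≡ true → orbitCount f S ≡ orbitCount f Q
  sameLayer {S} _ ∣S∣≡ᵇℓ = invariant⇒∣∣-determined (orbitCount-invariant f) {S} {Q}
    (trans (≡ᵇ⇒≡ _ _ (Equivalence.from T-≡ ∣S∣≡ᵇℓ)) (sym ∣Q∣≡ℓ))

-- Blocks

∣++∣ : ∀ {a b} (S : Subset a) (T : Subset b) → ∣ S ++ T ∣ ≡ ∣ S ∣ + ∣ T ∣
∣++∣ []          T = refl
∣++∣ (true  ∷ S) T = cong suc (∣++∣ S T)
∣++∣ (false ∷ S) T = ∣++∣ S T

++-disjoint : ∀ {a b} {S S′ : Subset a} {T T′ : Subset b} →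
              Empty (S ∩ S′) → Empty (T ∩ T′) → Empty ((S ++ T) ∩ (S′ ++ T′))
++-disjoint {S = []}    {[]}      _     T∩T′ = T∩T′
++-disjoint {S = _ ∷ _} {_ ∷ _} S∩S′ T∩T′ (fzero , x∈) =
  S∩S′ (fzero , lookup⇒[]= fzero _ ([]=⇒lookup x∈))
++-disjoint {S = _ ∷ _} {_ ∷ _} S∩S′ T∩T′ (fsuc x , x∈) =
  ++-disjoint (drop-∷-Empty S∩S′) T∩T′ (x , lookup⇒[]= x _ ([]=⇒lookup x∈))

image-disjoint : ∀ {m l} (y : Vec (Fin m) l) → Injective _≡_ _≡_ (lookup y) → ∀ {S T} →
                 Empty (S ∩ T) → Empty (image y S ∩ image y T)
image-disjoint y y-inj {S} {T} S∩T (x , x∈)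
  with x∈S , x∈T ← x∈p∩q⁻ (image y S) (image y T) x∈
  with p , Sp , refl ← lookup-image⁻ y S ([]=⇒lookup x∈S)
  with q , Tq , yq≡yp ← lookup-image⁻ y T ([]=⇒lookup x∈T)
  with refl ← y-inj yq≡yp
  = S∩T (p , x∈p∩q⁺ (lookup⇒[]= p S Sp , lookup⇒[]= p T Tq))

∣initialSegment∣ : ∀ N b → b ≤ N → ∣ tabulate {n = N} (λ p → toℕ p <ᵇ b) ∣ ≡ b
∣initialSegment∣ zero    zero    _         = refl
∣initialSegment∣ (suc N) zero    _         = ∣initialSegment∣ N zero z≤n
∣initialSegment∣ (suc N) (suc b) (s≤s b≤N) = cong suc (∣initialSegment∣ N b b≤N)

∣interval∣ : ∀ N a b → a + b ≤ N → ∣ tabulate {n = N} (λ p → (a ≤ᵇ toℕ p) ∧ (toℕ p <ᵇ a + b)) ∣ ≡ b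
∣interval∣ N       zero    b a+b≤N         = ∣initialSegment∣ N b a+b≤N
∣interval∣ (suc N) (suc a) b (s≤s a+b≤N) =
  trans (cong (∣_∣ {n = N}) (tabulate-cong (λ p → cong (_∧ (toℕ p <ᵇ a + b)) (<ᵇ-suc a (toℕ p)))))
        (∣interval∣ N a b a+b≤N)
  where
  <ᵇ-suc : ∀ a t → (a <ᵇ suc t) ≡ (a ≤ᵇ t)
  <ᵇ-suc zero    t = refl
  <ᵇ-suc (suc a) t = refl

offset+k≤total : ∀ {s} (k : Vec ℕ s) i → offset k i + lookup k i ≤ total k
offset+k≤total (x ∷ k) fzero    = m≤m+n x _
offset+k≤total (x ∷ k) (fsuc i) =
  subst (_≤ x + total k) (sym (+-assoc x (offset k i) (lookup k i))) (+-monoʳ-≤ x (offset+k≤total k i))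

offset+k≤offset : ∀ {s} (k : Vec ℕ s) {i j} → toℕ i < toℕ j → offset k i + lookup k i ≤ offset k j
offset+k≤offset (x ∷ k) {fzero}  {fsuc j} _         = m≤m+n x _
offset+k≤offset (x ∷ k) {fsuc i} {fsuc j} (s≤s i<j) =
  subst (_≤ x + offset k j) (sym (+-assoc x (offset k i) (lookup k i))) (+-monoʳ-≤ x (offset+k≤offset k i<j))

∣blockMask∣ : ∀ {s} (k : Vec ℕ s) i → ∣ blockMask k i ∣ ≡ lookup k i
∣blockMask∣ k i = ∣interval∣ (total k) (offset k i) (lookup k i) (offset+k≤total k i)

lookup-blockMask : ∀ {s} (k : Vec ℕ s) i p → lookup (blockMask k i) p ≡ true →
                   offset k i ≤ toℕ p × toℕ p < offset k i + lookup k i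
lookup-blockMask k i p p∈
  with lo , hi ← Equivalence.to T-∧ (Equivalence.from T-≡ (trans (sym (lookup∘tabulate _ p)) p∈))
  = ≤ᵇ⇒≤ _ _ lo , <ᵇ⇒< _ _ hi

blockMask-disjoint : ∀ {s} (k : Vec ℕ s) {i j} → i ≢ j → Empty (blockMask k i ∩ blockMask k j)
blockMask-disjoint k {i} {j} i≢j (p , p∈) with p∈i , p∈j ← x∈p∩q⁻ (blockMask k i) _ p∈
  with lookup-blockMask k i p ([]=⇒lookup p∈i) | lookup-blockMask k j p ([]=⇒lookup p∈j)
     | <-cmp (toℕ i) (toℕ j)
... | _ , p<endᵢ | startⱼ≤p , _ | tri< i<j _ _ =
  <-irrefl refl (<-≤-trans p<endᵢ (≤-trans (offset+k≤offset k i<j) startⱼ≤p))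
... | _ , _ | _ , _ | tri≈ _ i≡j _ = i≢j (toℕ-injective i≡j)
... | startᵢ≤p , _ | _ , p<endⱼ | tri> _ _ j<i =
  <-irrefl refl (<-≤-trans p<endⱼ (≤-trans (offset+k≤offset k j<i) startᵢ≤p))

derived-crossDependent : ∀ {s r} (k : Vec ℕ s) (𝓕 : Fin s → Family (total k + r)) y → IsPerm y →
                         CrossDependent 𝓕 → CrossDependent (derived k y 𝓕)
derived-crossDependent k 𝓕 y y! 𝓕-dependent (G , G∈𝓖 , G-disjoint) =
  𝓕-dependent ((λ i → image y (blockMask k i ++ G i)) , G∈𝓖 , λ i j i≢j →
    image-disjoint y (unique⇒lookup-injective y!) (++-disjoint (blockMask-disjoint k i≢j) (G-disjoint i j i≢j)))

derived-layerCount : ∀ {s r} (k : Vec ℕ s) (𝓕 : Fin s → Family (total k + r)) i j →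
  ∑[ y ← allPerms (total k + r) ] layerCount (derived k y 𝓕 i) j * ((total k + r) C (lookup k i + j))
  ≡ length (allPerms (total k + r)) * (r C j) * layerCount (𝓕 i) (lookup k i + j)
derived-layerCount {r = r} k 𝓕 i j = begin
  ∑[ y ← allPerms N ] layerCount (derived k y 𝓕 i) j * c
    ≡⟨ cong (_* c) (∑-cong (allPerms N) (λ {y} _ → layerCount≡∑ (derived k y 𝓕 i) j)) ⟩
  ∑[ y ← allPerms N ] ∑[ G ← allSubsets r ] (𝕀 (∣ G ∣ ≡ᵇ j) * 𝕀 (f (image y (M ++ G)))) * c
    ≡⟨ cong (_* c) (∑-comm (allPerms N) (allSubsets r) _) ⟩
  ∑[ G ← allSubsets r ] ∑[ y ← allPerms N ] (𝕀 (∣ G ∣ ≡ᵇ j) * 𝕀 (f (image y (M ++ G)))) * c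
    ≡⟨ cong (_* c) (∑-cong (allSubsets r) (λ {G} _ → ∑-*ˡ (allPerms N) (𝕀 (∣ G ∣ ≡ᵇ j)) _)) ⟩
  ∑[ G ← allSubsets r ] (𝕀 (∣ G ∣ ≡ᵇ j) * orbitCount f (M ++ G)) * c
    ≡⟨ ∑-*ʳ (allSubsets r) c _ ⟨
  ∑[ G ← allSubsets r ] (𝕀 (∣ G ∣ ≡ᵇ j) * orbitCount f (M ++ G) * c)
    ≡⟨ ∑-cong (allSubsets r) (λ {G} _ → *-assoc (𝕀 (∣ G ∣ ≡ᵇ j)) _ c) ⟩
  ∑[ G ← allSubsets r ] (𝕀 (∣ G ∣ ≡ᵇ j) * (orbitCount f (M ++ G) * c))
    ≡⟨ ∑-indicator (allSubsets r) (λ G → ∣ G ∣ ≡ᵇ j) (λ G → orbitCount f (M ++ G) * c) _ layer ⟩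
  ∑[ G ← allSubsets r ] 𝕀 (∣ G ∣ ≡ᵇ j) * (#P * L)
    ≡⟨ cong (_* (#P * L)) (∑𝕀[∣S∣≡j]≡mCj r j) ⟩
  (r C j) * (#P * L)
    ≡⟨ *-assoc (r C j) _ _ ⟨
  (r C j) * #P * L
    ≡⟨ cong (_* L) (*-comm (r C j) _) ⟩
  #P * (r C j) * L ∎
  where
  open ≡-Reasoning
  N = total k + r
  M = blockMask k i
  f = 𝓕 i
  m = lookup k i + j
  c = N C m
  #P = length (allPerms N)
  L = layerCount f m
  layer : ∀ {G} → G ∈ allSubsets r → (∣ G ∣ ≡ᵇ j) ≡ true →
          orbitCount f (M ++ G) * c ≡ #P * L
  layer {G} _ ∣G∣≡ᵇj = orbitCount-layer f (M ++ G)
    (trans (∣++∣ M G) (cong₂ _+_ (∣blockMask∣ k i) (≡ᵇ⇒≡ _ _ (Equivalence.from T-≡ ∣G∣≡ᵇj))))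

mainTheorem6 : (s r : ℕ) (k : Vec ℕ s) (𝓕 : Fin s → Family (total k + r)) →
    ((y : Vec (Fin (total k + r)) (total k + r)) → IsPerm y →
      CrossDependent 𝓕 → CrossDependent (derived k y 𝓕))
    ×
    ((i : Fin s) (j : ℕ) → j ≤ r →
      sum (map (λ y → layerCount (derived k y 𝓕 i) j) (allPerms (total k + r)))
        * ((total k + r) C (lookup k i + j))
      ≡ length (allPerms (total k + r)) * (r C j) * layerCount (𝓕 i) (lookup k i + j))
mainTheorem6 s r k 𝓕 = derived-crossDependent k 𝓕 , λ i j _ → derived-layerCount k 𝓕 i j
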